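{- In the logic $\mathcal{IR}$Ł, with order limits $\lim^o$: (i) if $\varphi=\lim^o_n\varphi_n$ then $\neg\varphi=\lim^o_n\neg\varphi_n$; (ii) if $\varphi=\lim^o_n\varphi_n$ and $\psi=\lim^o_n\psi_n$ then $\varphi\odot\psi=\lim^o_n(\varphi_n\odot\psi_n)$; (iii) if $\varphi$ and $\psi$ are both order limits of the same sequence $(\varphi_n)$, then $\vdash\varphi\leftrightarrow\psi$; (iv) if $\varphi=\lim^o_n\varphi_n$ and $\vdash\varphi\leftrightarrow\psi$, then $\psi=\lim^o_n\varphi_n$; (v) if $\varphi=\lim^o_n\varphi_n$ and $\psi=\lim^o_n\psi_n$ then $\varphi\oplus\psi=\lim^o_n(\varphi_n\oplus\psi_n)$.
   Context: The logic $\mathcal{IR}$Ł: connectives $\neg,\to,\nabla_\alpha$ ($\alpha\in[0,1]$), countable disjunction $\bigvee_n\varphi_n$ (finite ones padded with a false constant $\bot$); abbreviations $\varphi\odot\psi=\neg(\varphi\to\neg\psi)$, $\varphi\oplus\psi=\neg\varphi\to\psi$, $\varphi\leftrightarrow\psi=(\varphi\to\psi)\odot(\psi\to\varphi)$, $\Delta_\alpha\varphi=\neg\nabla_\alpha\neg\varphi$; axioms (L1) $\varphi\to(\psi\to\varphi)$; (L2) $(\varphi\to\psi)\to((\psi\to\chi)\to(\varphi\to\chi))$; (L3) $((\varphi\to\psi)\to\psi)\to((\psi\to\varphi)\to\varphi)$; (L4) $(\neg\psi\to\neg\varphi)\to(\varphi\to\psi)$; (R1) $\nabla_\alpha(\varphi\to\psi)\leftrightarrow(\nabla_\alpha\varphi\to\nabla_\alpha\psi)$;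 (R2) $\nabla_{\max(0,\alpha-\beta)}\varphi\leftrightarrow(\nabla_\beta\varphi\to\nabla_\alpha\varphi)$; (R3) $\nabla_\alpha\nabla_\beta\varphi\leftrightarrow\nabla_{\alpha\beta}\varphi$; (R4) $\nabla_1\varphi\leftrightarrow\varphi$; (S1) $\varphi_k\to\bigvee_n\varphi_n$; rules Modus Ponens and (SUP): from $\varphi_k\to\psi$ for all $k$ infer $\bigvee_n\varphi_n\to\psi$. A sequence $(\psi_n)$ is increasing if $\vdash\psi_k\to\psi_{k+1}$ for all $k$. A formula $\varphi$ is the order limit of $(\varphi_n)_{n\in\mathbb N}$, written $\varphi=\lim^o_n\varphi_n$, iff there is an increasing sequence $(\psi_n)$ with $\vdash\bigvee_n\psi_n$ and $\vdash\psi_n\to(\varphi\leftrightarrow\varphi_n)$ for all $n$. -}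

module Defs where

open import Data.Nat using (ℕ; suc)
open import Data.Product using (Σ; _×_)

record Scalars : Set₁ where
  field
    Carrier : Set
    one     : Carrier
    _∸ˢ_    : Carrier → Carrier → Carrier   -- max(0, α - β)
    _*ˢ_    : Carrier → Carrier → Carrier

module Logic (S : Scalars) (Var : Set) where
  open Scalars S

  infixr 4 _⇒_
  infix 6 ¬'_

  data Form : Set where
    var  : Var → Form
    ¬'_  : Form → Form
    _⇒_  : Form → Form → Form
    ∇    : Carrier → Form → Form
    ⋁    : (ℕ → Form) → Form

  _⊙_ : Form → Form → Form
  φ ⊙ ψ = ¬' (φ ⇒ ¬' ψ)

  _⊕_ : Form → Form → Form
  φ ⊕ ψ = ¬' φ ⇒ ψ

  _⇔_ : Form → Form → Form
  φ ⇔ ψ = (φ ⇒ ψ) ⊙ (ψ ⇒ φ)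

  Δ : Carrier → Form → Form
  Δ α φ = ¬' ∇ α (¬' φ)

  infix 2 ⊢_
  data ⊢_ : Form → Set where
    L1  : ∀ φ ψ → ⊢ φ ⇒ (ψ ⇒ φ)
    L2  : ∀ φ ψ χ → ⊢ (φ ⇒ ψ) ⇒ ((ψ ⇒ χ) ⇒ (φ ⇒ χ))
    L3  : ∀ φ ψ → ⊢ ((φ ⇒ ψ) ⇒ ψ) ⇒ ((ψ ⇒ φ) ⇒ φ)
    L4  : ∀ φ ψ → ⊢ (¬' ψ ⇒ ¬' φ) ⇒ (φ ⇒ ψ)
    R1  : ∀ α φ ψ → ⊢ ∇ α (φ ⇒ ψ) ⇔ (∇ α φ ⇒ ∇ α ψ)
    R2  : ∀ α β φ → ⊢ ∇ (α ∸ˢ β) φ ⇔ (∇ β φ ⇒ ∇ α φ)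
    R3  : ∀ α β φ → ⊢ ∇ α (∇ β φ) ⇔ ∇ (α *ˢ β) φ
    R4  : ∀ φ → ⊢ ∇ one φ ⇔ φ
    S1  : ∀ (φs : ℕ → Form) k → ⊢ φs k ⇒ ⋁ φs
    MP  : ∀ {φ ψ} → ⊢ φ → ⊢ φ ⇒ ψ → ⊢ ψ
    SUP : ∀ {φs : ℕ → Form} {ψ} → (∀ k → ⊢ φs k ⇒ ψ) → ⊢ ⋁ φs ⇒ ψ

  Increasing : (ℕ → Form) → Set
  Increasing ψs = ∀ k → ⊢ ψs k ⇒ ψs (suc k)

  IsOrderLimit : Form → (ℕ → Form) → Set
  IsOrderLimit φ φs =
    Σ (ℕ → Form) λ ψs →
      Increasing ψs × (⊢ ⋁ ψs) × (∀ n → ⊢ ψs n ⇒ (φ ⇔ φs n))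

-- Provable equivalence is a congruence for ¬, ⊙ and ⊕ in the
-- strong form ⊢ (a ⇔ b) ⊙ (c ⇔ d) ⇒ (a ⊙ c ⇔ b ⊙ d), so a witness θ for
-- φ = lim φs and a witness θ′ for ψ = lim ψs combine into the witness
-- n ↦ θ n ⊙ θ′ n for the combined limit.  That sequence is increasing, and
-- its supremum is provable because the witnesses are increasing: θ m ⊙ θ′ k
-- lies below θ (m ⊔ k) ⊙ θ′ (m ⊔ k).  Uniqueness chains φ ⇔ φs n ⇔ ψ under
-- the combined witness and discharges it with SUP.
module Submission where

open import Defs
open import Data.Nat using (ℕ; _≤′_; _⊔_; ≤′-refl; ≤′-step)
open import Data.Nat.Properties using (≤⇒≤′; m≤m⊔n; m≤n⊔m)
open import Data.Product using (_×_; _,_)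

module OrderLimits (S : Scalars) (Var : Set) where
  open Logic S Var

  ⇒-trans : ∀ {a b c} → ⊢ a ⇒ b → ⊢ b ⇒ c → ⊢ a ⇒ c
  ⇒-trans {a} {b} {c} p q = MP q (MP p (L2 a b c))

  ⇒-antimonoˡ : ∀ {a b} c → ⊢ a ⇒ b → ⊢ (b ⇒ c) ⇒ (a ⇒ c)
  ⇒-antimonoˡ {a} {b} c p = MP p (L2 a b c)

  assertion : ∀ a b → ⊢ a ⇒ ((a ⇒ b) ⇒ b)
  assertion a b = ⇒-trans (L1 a (b ⇒ a)) (L3 b a)

  permutation : ∀ a b c → ⊢ (a ⇒ (b ⇒ c)) ⇒ (b ⇒ (a ⇒ c))
  permutation a b c = ⇒-trans (L2 a (b ⇒ c) c) (⇒-antimonoˡ (a ⇒ c) (assertion b c))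

  permute : ∀ {a b c} → ⊢ a ⇒ (b ⇒ c) → ⊢ b ⇒ (a ⇒ c)
  permute {a} {b} {c} p = MP p (permutation a b c)

  prefixing : ∀ a b c → ⊢ (b ⇒ c) ⇒ ((a ⇒ b) ⇒ (a ⇒ c))
  prefixing a b c = permute (L2 a b c)

  ⇒-monoʳ : ∀ {b c} a → ⊢ b ⇒ c → ⊢ (a ⇒ b) ⇒ (a ⇒ c)
  ⇒-monoʳ {b} {c} a p = MP p (prefixing a b c)

  ⇒-refl : ∀ a → ⊢ a ⇒ a
  ⇒-refl a = MP (L1 a a) (permute (L1 a (a ⇒ (a ⇒ a))))

  ¬¬-elim : ∀ a → ⊢ ¬' ¬' a ⇒ a
  ¬¬-elim a = MP (L1 a a) (permute (⇒-trans (L1 (¬' ¬' a) (¬' ¬' ⊤))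
                (⇒-trans (L4 (¬' a) (¬' ⊤)) (L4 ⊤ a))))
    where ⊤ = a ⇒ (a ⇒ a)

  ¬¬-intro : ∀ a → ⊢ a ⇒ ¬' ¬' a
  ¬¬-intro a = MP (¬¬-elim (¬' a)) (L4 a (¬' ¬' a))

  contraposition : ∀ a b → ⊢ (a ⇒ b) ⇒ (¬' b ⇒ ¬' a)
  contraposition a b =
    ⇒-trans (⇒-trans (⇒-antimonoˡ b (¬¬-elim a)) (⇒-monoʳ (¬' ¬' a) (¬¬-intro b)))
            (L4 (¬' b) (¬' a))

  contrapose : ∀ {a b} → ⊢ a ⇒ b → ⊢ ¬' b ⇒ ¬' a
  contrapose {a} {b} p = MP p (contraposition a b)

  uncurry-⊙ : ∀ {a b c} → ⊢ a ⇒ (b ⇒ c) → ⊢ a ⊙ b ⇒ c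
  uncurry-⊙ {a} {b} {c} p =
    ⇒-trans (contrapose (permute (⇒-trans p (contraposition b c)))) (¬¬-elim c)

  curry-⊙ : ∀ {a b c} → ⊢ a ⊙ b ⇒ c → ⊢ a ⇒ (b ⇒ c)
  curry-⊙ {a} {b} {c} p =
    ⇒-trans (permute (⇒-trans (contrapose p) (¬¬-elim (a ⇒ ¬' b)))) (L4 b c)

  ⊙-intro : ∀ a b → ⊢ a ⇒ (b ⇒ a ⊙ b)
  ⊙-intro a b = curry-⊙ (⇒-refl (a ⊙ b))

  ⊙-comm : ∀ a b → ⊢ a ⊙ b ⇒ b ⊙ a
  ⊙-comm a b = uncurry-⊙ (permute (⊙-intro b a))

  ⊙-mono : ∀ {a a′ b b′} → ⊢ a ⇒ a′ → ⊢ b ⇒ b′ → ⊢ a ⊙ b ⇒ a′ ⊙ b′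
  ⊙-mono {a′ = a′} {b′ = b′} p q =
    uncurry-⊙ (⇒-trans (⇒-trans p (⊙-intro a′ b′)) (⇒-antimonoˡ (a′ ⊙ b′) q))

  ⊙-monoˡ : ∀ {a a′} b → ⊢ a ⇒ a′ → ⊢ a ⊙ b ⇒ a′ ⊙ b
  ⊙-monoˡ b p = ⊙-mono p (⇒-refl b)

  ⊙-monoʳ : ∀ {b b′} a → ⊢ b ⇒ b′ → ⊢ a ⊙ b ⇒ a ⊙ b′
  ⊙-monoʳ a q = ⊙-mono (⇒-refl a) q

  ⊙-assoc : ∀ a b c → ⊢ (a ⊙ b) ⊙ c ⇒ a ⊙ (b ⊙ c)
  ⊙-assoc a b c = uncurry-⊙ (uncurry-⊙ (⇒-trans (⊙-intro a (b ⊙ c)) curried))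
    where
    curried : ⊢ ((b ⊙ c) ⇒ a ⊙ (b ⊙ c)) ⇒ (b ⇒ (c ⇒ a ⊙ (b ⊙ c)))
    curried = ⇒-trans (permute (L2 c (b ⊙ c) (a ⊙ (b ⊙ c))))
                      (⇒-antimonoˡ _ (⊙-intro b c))

  ⊙-assoc⁻ : ∀ a b c → ⊢ a ⊙ (b ⊙ c) ⇒ (a ⊙ b) ⊙ c
  ⊙-assoc⁻ a b c =
    ⇒-trans (⊙-comm a (b ⊙ c)) (⇒-trans (⊙-assoc b c a) (⇒-trans (⊙-comm b (c ⊙ a))
    (⇒-trans (⊙-assoc c a b) (⊙-comm c (a ⊙ b)))))

  ⊙-interchange : ∀ a b c d → ⊢ (a ⊙ b) ⊙ (c ⊙ d) ⇒ (b ⊙ c) ⊙ (a ⊙ d)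
  ⊙-interchange a b c d =
    ⇒-trans (⊙-monoˡ (c ⊙ d) (⊙-comm a b))
    (⇒-trans (⊙-assoc b a (c ⊙ d))
    (⇒-trans (⊙-monoʳ b (⊙-assoc⁻ a c d))
    (⇒-trans (⊙-monoʳ b (⊙-monoˡ d (⊙-comm a c)))
    (⇒-trans (⊙-monoʳ b (⊙-assoc c a d))
             (⊙-assoc⁻ b c (a ⊙ d))))))

  ⇔-sym : ∀ a b → ⊢ (a ⇔ b) ⇒ (b ⇔ a)
  ⇔-sym a b = ⊙-comm (a ⇒ b) (b ⇒ a)

  ⇔-trans : ∀ a b c → ⊢ (a ⇔ b) ⊙ (b ⇔ c) ⇒ (a ⇔ c)
  ⇔-trans a b c =
    ⇒-trans (⊙-monoˡ (b ⇔ c) (⊙-comm (a ⇒ b) (b ⇒ a)))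
    (⇒-trans (⊙-interchange (b ⇒ a) (a ⇒ b) (b ⇒ c) (c ⇒ b))
    (⊙-mono (compose a b c) (⇒-trans (⊙-comm (b ⇒ a) (c ⇒ b)) (compose c b a))))
    where
    compose : ∀ x y z → ⊢ (x ⇒ y) ⊙ (y ⇒ z) ⇒ (x ⇒ z)
    compose x y z = uncurry-⊙ (L2 x y z)

  Congruent₁ : (Form → Form) → Set
  Congruent₁ G = ∀ a b → ⊢ (a ⇔ b) ⇒ (G a ⇔ G b)

  Congruent₂ : (Form → Form → Form) → Set
  Congruent₂ F = ∀ a b c d → ⊢ (a ⇔ b) ⊙ (c ⇔ d) ⇒ (F a c ⇔ F b d)

  ¬-cong : Congruent₁ ¬'_
  ¬-cong a b = ⇒-trans (⊙-comm (a ⇒ b) (b ⇒ a))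
                       (⊙-mono (contraposition b a) (contraposition a b))

  ⇒-cong : Congruent₂ _⇒_
  ⇒-cong a b c d =
    ⇒-trans (⊙-interchange (a ⇒ b) (b ⇒ a) (c ⇒ d) (d ⇒ c))
            (⊙-mono (uncurry-⊙ (sandwich (L2 b a c) (prefixing b c d)))
                    (uncurry-⊙ (sandwich (L2 a b d) (prefixing a d c))))
    where
    sandwich : ∀ {p q r s t} → ⊢ p ⇒ (q ⇒ r) → ⊢ s ⇒ (r ⇒ t) → ⊢ p ⇒ (s ⇒ (q ⇒ t))
    sandwich {q = q} {r} {t = t} f g =
      ⇒-trans (⇒-trans f (L2 q r t)) (⇒-antimonoˡ (q ⇒ t) g)

  ⊙-cong : Congruent₂ _⊙_
  ⊙-cong a b c d =
    ⇒-trans (⊙-monoʳ (a ⇔ b) (¬-cong c d))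
    (⇒-trans (⇒-cong a b (¬' c) (¬' d)) (¬-cong (a ⇒ ¬' c) (b ⇒ ¬' d)))

  ⊕-cong : Congruent₂ _⊕_
  ⊕-cong a b c d =
    ⇒-trans (⊙-monoˡ (c ⇔ d) (¬-cong a b)) (⇒-cong (¬' a) (¬' b) c d)

  Increasing⇒≤′-mono : ∀ {θ} → Increasing θ → ∀ {m n} → m ≤′ n → ⊢ θ m ⇒ θ n
  Increasing⇒≤′-mono inc ≤′-refl      = ⇒-refl _
  Increasing⇒≤′-mono inc (≤′-step m≤n) = ⇒-trans (Increasing⇒≤′-mono inc m≤n) (inc _)

  _⊙ˢ_ : (ℕ → Form) → (ℕ → Form) → ℕ → Form
  (θ ⊙ˢ θ′) n = θ n ⊙ θ′ n

  ⊙ˢ-increasing : ∀ {θ θ′} → Increasing θ → Increasing θ′ → Increasing (θ ⊙ˢ θ′)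
  ⊙ˢ-increasing inc inc′ k = ⊙-mono (inc k) (inc′ k)

  ⊢⋁-⊙ˢ : ∀ {θ θ′} → Increasing θ → Increasing θ′ → ⊢ ⋁ θ → ⊢ ⋁ θ′ → ⊢ ⋁ (θ ⊙ˢ θ′)
  ⊢⋁-⊙ˢ {θ} {θ′} inc inc′ ⊢⋁θ ⊢⋁θ′ =
    MP ⊢⋁θ′ (SUP λ k → MP ⊢⋁θ (SUP λ m → below-⋁ m k))
    where
    below-⋁ : ∀ m k → ⊢ θ m ⇒ (θ′ k ⇒ ⋁ (θ ⊙ˢ θ′))
    below-⋁ m k =
      ⇒-trans (Increasing⇒≤′-mono inc (≤⇒≤′ (m≤m⊔n m k)))
      (⇒-trans (⇒-trans (⊙-intro (θ (m ⊔ k)) (θ′ (m ⊔ k))) (⇒-monoʳ _ (S1 (θ ⊙ˢ θ′) (m ⊔ k))))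
               (⇒-antimonoˡ _ (Increasing⇒≤′-mono inc′ (≤⇒≤′ (m≤n⊔m m k)))))

  isOrderLimit-map : ∀ {G} → Congruent₁ G → ∀ φ φs →
                     IsOrderLimit φ φs → IsOrderLimit (G φ) (λ n → G (φs n))
  isOrderLimit-map G-cong φ φs (θ , inc , ⊢⋁θ , lim) =
    θ , inc , ⊢⋁θ , λ n → ⇒-trans (lim n) (G-cong φ (φs n))

  isOrderLimit-zipWith : ∀ {F} → Congruent₂ F → ∀ φ ψ φs ψs →
                         IsOrderLimit φ φs → IsOrderLimit ψ ψs →
                         IsOrderLimit (F φ ψ) (λ n → F (φs n) (ψs n))
  isOrderLimit-zipWith F-cong φ ψ φs ψs (θ , inc , ⊢⋁θ , lim) (θ′ , inc′ , ⊢⋁θ′ , lim′) =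
    θ ⊙ˢ θ′ , ⊙ˢ-increasing inc inc′ , ⊢⋁-⊙ˢ inc inc′ ⊢⋁θ ⊢⋁θ′ ,
    λ n → ⇒-trans (⊙-mono (lim n) (lim′ n)) (F-cong φ (φs n) ψ (ψs n))

  isOrderLimit-unique : ∀ φ ψ φs → IsOrderLimit φ φs → IsOrderLimit ψ φs → ⊢ φ ⇔ ψ
  isOrderLimit-unique φ ψ φs (θ , inc , ⊢⋁θ , lim) (θ′ , inc′ , ⊢⋁θ′ , lim′) =
    MP (⊢⋁-⊙ˢ inc inc′ ⊢⋁θ ⊢⋁θ′) (SUP λ n →
      ⇒-trans (⊙-mono (lim n) (⇒-trans (lim′ n) (⇔-sym ψ (φs n)))) (⇔-trans φ (φs n) ψ))

  isOrderLimit-resp-⇔ : ∀ φ ψ φs → IsOrderLimit φ φs → ⊢ φ ⇔ ψ → IsOrderLimit ψ φs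
  isOrderLimit-resp-⇔ φ ψ φs (θ , inc , ⊢⋁θ , lim) φ⇔ψ =
    θ , inc , ⊢⋁θ , λ n → ⇒-trans (⇒-trans (lim n) (MP ψ⇔φ (⊙-intro (ψ ⇔ φ) _)))
                                  (⇔-trans ψ φ (φs n))
    where
    ψ⇔φ : ⊢ ψ ⇔ φ
    ψ⇔φ = MP φ⇔ψ (⇔-sym φ ψ)

proposition3p7 : (S : Scalars) (Var : Set) →
    let open Logic S Var in
    (∀ (φ : Form) (φs : ℕ → Form) →
    IsOrderLimit φ φs → IsOrderLimit (¬' φ) (λ n → ¬' φs n))
    ×
    (∀ (φ ψ : Form) (φs ψs : ℕ → Form) →
    IsOrderLimit φ φs → IsOrderLimit ψ ψs →
    IsOrderLimit (φ ⊙ ψ) (λ n → φs n ⊙ ψs n))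
    ×
    (∀ (φ ψ : Form) (φs : ℕ → Form) →
    IsOrderLimit φ φs → IsOrderLimit ψ φs → ⊢ φ ⇔ ψ)
    ×
    (∀ (φ ψ : Form) (φs : ℕ → Form) →
    IsOrderLimit φ φs → ⊢ φ ⇔ ψ → IsOrderLimit ψ φs)
    ×
    (∀ (φ ψ : Form) (φs ψs : ℕ → Form) →
    IsOrderLimit φ φs → IsOrderLimit ψ ψs →
    IsOrderLimit (φ ⊕ ψ) (λ n → φs n ⊕ ψs n))
proposition3p7 S Var =
  isOrderLimit-map ¬-cong ,
  isOrderLimit-zipWith ⊙-cong ,
  isOrderLimit-unique ,
  isOrderLimit-resp-⇔ ,
  isOrderLimit-zipWith ⊕-cong
  where open OrderLimits S Var
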